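{- For every integer $k$, there exists a tree $T$ with $\gamma^{NN}_{s}(T)=k$.
   Context: For a vertex $v$, $N[v]=N(v)\cup\{v\}$; for $f:V(G)\to\mathbb{R}$ and $S\subseteq V(G)$, $f(S)=\sum_{v\in S}f(v)$. A nonnegative signed dominating function (NNSDF) of a graph $G$ is a function $f:V(G)\to\{ -1,1\}$ with $f(N[v])\ge 0$ for every $v\in V(G)$; $\gamma^{NN}_s(G)$ is the minimum of $f(V(G))$ over all NNSDFs $f$ of $G$. -}

module Defs where

open import Data.Nat using (ℕ; zero; suc; _≤_)
open import Data.Integer using (ℤ; +_; _+_; -_; 0ℤ; 1ℤ)
import Data.Integer as ℤ
open import Data.Fin using (Fin; zero; suc)
open import Data.Bool using (Bool; true; false; if_then_else_)
open import Data.List using (List; []; _∷_; _++_; [_]; length)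
open import Data.List.Relation.Unary.Linked using (Linked)
open import Data.List.Relation.Unary.Unique.Propositional using (Unique)
open import Data.Product using (Σ; _×_; ∃)
open import Data.Sum using (_⊎_)
open import Relation.Binary.PropositionalEquality using (_≡_)
open import Relation.Nullary using (¬_)

record Graph : Set where
  field
    n     : ℕ
    adj   : Fin n → Fin n → Bool
    sym   : ∀ u v → adj u v ≡ adj v u
    irrefl : ∀ v → adj v v ≡ false
open Graph public

Adj : (G : Graph) → Fin (n G) → Fin (n G) → Set
Adj G u v = adj G u v ≡ true

data Walk (G : Graph) : Fin (n G) → Fin (n G) → Set where
  here : ∀ {u} → Walk G u u
  step : ∀ {u w v} → Adj G u w → Walk G w v → Walk G u v

Connected : Graph → Set
Connected G = ∀ u v → Walk G u v

HasCycle : Graph → Set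
HasCycle G = Σ (Fin (n G)) λ x → Σ (List (Fin (n G))) λ xs →
  (3 ≤ length (x ∷ xs)) × Unique (x ∷ xs) × Linked (Adj G) (x ∷ xs ++ [ x ])

Acyclic : Graph → Set
Acyclic G = ¬ HasCycle G

IsTree : Graph → Set
IsTree G = (1 ≤ n G) × Connected G × Acyclic G

sumFin : ∀ {m} → (Fin m → ℤ) → ℤ
sumFin {zero} f = 0ℤ
sumFin {suc m} f = f zero + sumFin (λ i → f (suc i))

closedNbhdSum : (G : Graph) → (Fin (n G) → ℤ) → Fin (n G) → ℤ
closedNbhdSum G f v = f v + sumFin (λ u → if adj G v u then f u else 0ℤ)

weight : (G : Graph) → (Fin (n G) → ℤ) → ℤ
weight G f = sumFin f

IsNNSDF : (G : Graph) → (Fin (n G) → ℤ) → Set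
IsNNSDF G f = (∀ v → (f v ≡ 1ℤ) ⊎ (f v ≡ - 1ℤ)) × (∀ v → 0ℤ ℤ.≤ closedNbhdSum G f v)

NNSignedDomNumberIs : Graph → ℤ → Set
NNSignedDomNumberIs G k =
  (Σ (Fin (n G) → ℤ) λ f → IsNNSDF G f × weight G f ≡ k) ×
  (∀ g → IsNNSDF G g → k ℤ.≤ weight G g)

-- Hang m copies of the path P₃ from a new vertex h. If they hang from an end, each
-- copy is the closed neighbourhood of its middle vertex, so its weight under an NNSDF f
-- is a nonnegative sum of three signs, hence at least 1; with f(h) ≥ -1 every NNSDF
-- weighs at least m - 1, attained by f(h) = -1 and the signs 1, 1, -1 along each copy.
-- If they hang from their centres c, then f(h) + f(copy) = f(N[c]) ≥ 0, so every NNSDF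
-- weighs at least f(h)(1 - m) ≥ 1 - m, attained by f = 1 on h and the centres and -1
-- on the leaves. Both graphs are trees because every edge joins a vertex to its parent
-- with respect to a rank-decreasing parent function.
module Submission where

open import Defs
open import Data.Integer using (ℤ)
open import Data.Product using (Σ; _×_)

open import Data.Bool using (Bool; true; false; _∧_; _∨_; if_then_else_)
open import Data.Bool.Properties using (∨-comm; ∨-zeroʳ)
open import Data.Empty using (⊥; ⊥-elim)
open import Data.Fin using (Fin; zero; suc; toℕ; inject₁; combine; remQuot; _↑ˡ_; _↑ʳ_)
open import Data.Fin.Patterns using (0F; 1F; 2F)
open import Data.Fin.Properties using (_≟_; remQuot-combine; combine-remQuot; toℕ-inject₁; toℕ<n)
open import Data.Integer using (+_; -[1+_]; 0ℤ; 1ℤ; -1ℤ; -_; _+_; _*_; _≤_; +≤+; -≤+)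
import Data.Integer.Properties as ℤP
open import Data.Integer.Tactic.RingSolver using (solve-∀)
open import Data.List using (List; []; _∷_; _++_)
open import Data.List.Relation.Unary.All as All using (All; _∷_)
open import Data.List.Relation.Unary.All.Properties using (++⁻ʳ)
open import Data.List.Relation.Unary.AllPairs using (AllPairs; _∷_)
open import Data.List.Relation.Unary.Linked as Linked using (Linked; [-]; _∷_)
open import Data.List.Relation.Unary.Linked.Properties using (Linked⇒AllPairs)
open import Data.Nat as ℕ using (ℕ; zero; suc; s≤s; z≤n)
import Data.Nat.Properties as ℕP
open import Data.Nat.Induction using (<-wellFounded)
open import Data.Product using (_,_; proj₂; map₂; uncurry)
open import Data.Sum as Sum using (_⊎_; inj₁; inj₂)
open import Function using (_∘_; flip; _on_)
open import Induction.WellFounded using (Acc; acc)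
import Relation.Binary.Construct.On as On
open import Relation.Binary.Definitions using (Transitive)
open import Relation.Binary.PropositionalEquality as ≡ using (_≡_; _≢_; refl; trans; cong; cong₂; subst; ≢-sym)
open import Relation.Nullary using (¬_; yes; no; does)
open import Relation.Nullary.Decidable using (dec-true; dec-false)

sumFin-cong : ∀ {m} {F G : Fin m → ℤ} → (∀ i → F i ≡ G i) → sumFin F ≡ sumFin G
sumFin-cong {zero}  _   = refl
sumFin-cong {suc m} F≗G = cong₂ _+_ (F≗G zero) (sumFin-cong (F≗G ∘ suc))

sumFin-mono : ∀ {m} {F G : Fin m → ℤ} → (∀ i → F i ≤ G i) → sumFin F ≤ sumFin G
sumFin-mono {zero}  _   = ℤP.≤-refl
sumFin-mono {suc m} F≤G = ℤP.+-mono-≤ (F≤G zero) (sumFin-mono (F≤G ∘ suc))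

sumFin-const : ∀ m c → sumFin {m} (λ _ → c) ≡ + m * c
sumFin-const zero    c = ≡.sym (ℤP.*-zeroˡ c)
sumFin-const (suc m) c = begin
  c + sumFin {m} (λ _ → c)  ≡⟨ cong (λ x → c + x) (sumFin-const m c) ⟩
  c + + m * c               ≡⟨ cong (λ x → x + + m * c) (≡.sym (ℤP.*-identityˡ c)) ⟩
  1ℤ * c + + m * c          ≡⟨ ≡.sym (ℤP.*-distribʳ-+ c 1ℤ (+ m)) ⟩
  + suc m * c               ∎
  where open ≡.≡-Reasoning

sumFin-zero : ∀ m → sumFin {m} (λ _ → 0ℤ) ≡ 0ℤ
sumFin-zero m = trans (sumFin-const m 0ℤ) (ℤP.*-zeroʳ (+ m))

sumFin-one : ∀ m → sumFin {m} (λ _ → 1ℤ) ≡ + m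
sumFin-one m = trans (sumFin-const m 1ℤ) (ℤP.*-identityʳ (+ m))

sumFin-minusOne : ∀ m → sumFin {m} (λ _ → -1ℤ) ≡ - + m
sumFin-minusOne m = trans (sumFin-const m -1ℤ) (trans (ℤP.*-comm (+ m) -1ℤ) (ℤP.-1*i≡-i (+ m)))

sumFin-splitAt : ∀ m {k} (F : Fin (m ℕ.+ k) → ℤ) →
                 sumFin F ≡ sumFin (F ∘ (_↑ˡ k)) + sumFin (F ∘ (m ↑ʳ_))
sumFin-splitAt zero    F = ≡.sym (ℤP.+-identityˡ (sumFin F))
sumFin-splitAt (suc m) F = trans (cong (λ x → F zero + x) (sumFin-splitAt m (F ∘ suc)))
                                 (≡.sym (ℤP.+-assoc (F zero) _ _))

sumFin-combine : ∀ m {t} (F : Fin (m ℕ.* t) → ℤ) →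
                 sumFin F ≡ sumFin {m} (λ i → sumFin {t} (λ r → F (combine i r)))
sumFin-combine zero        F = refl
sumFin-combine (suc m) {t} F = trans (sumFin-splitAt t F)
  (cong (λ x → sumFin (λ r → F (r ↑ˡ (m ℕ.* t))) + x) (sumFin-combine m (F ∘ (t ↑ʳ_))))

sumFin-indicator : ∀ {m} (i : Fin m) (F : Fin m → ℤ) →
                   sumFin (λ j → if does (i ≟ j) then F j else 0ℤ) ≡ F i
sumFin-indicator {suc m} zero    F = trans (cong (λ x → F zero + x) (sumFin-zero m)) (ℤP.+-identityʳ (F zero))
sumFin-indicator {suc m} (suc i) F = trans (ℤP.+-identityˡ _) (sumFin-indicator i (F ∘ suc))

sumFin-∧ : ∀ {t} b (c : Fin t → Bool) (F : Fin t → ℤ) →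
           sumFin (λ s → if b ∧ c s then F s else 0ℤ) ≡
           (if b then sumFin (λ s → if c s then F s else 0ℤ) else 0ℤ)
sumFin-∧     true  c F = refl
sumFin-∧ {t} false c F = sumFin-zero t

module _ {G : Graph} where

  _++ʷ_ : ∀ {u v w} → Walk G u v → Walk G v w → Walk G u w
  here     ++ʷ q = q
  step e p ++ʷ q = step e (p ++ʷ q)

  reverseʷ : ∀ {u v} → Walk G u v → Walk G v u
  reverseʷ here               = here
  reverseʷ (step {u} {w} e p) = reverseʷ p ++ʷ step (trans (Graph.sym G w u) e) here

data NonBacktracking {A : Set} : List A → Set where
  [-,-] : ∀ {a b} → NonBacktracking (a ∷ b ∷ [])
  _∷_   : ∀ {a b c cs} → a ≢ c → NonBacktracking (b ∷ c ∷ cs) →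
          NonBacktracking (a ∷ b ∷ c ∷ cs)

nonBacktracking-++ : ∀ {A : Set} {u w : A} cs {y z} →
                     AllPairs _≢_ (u ∷ w ∷ cs) → All (y ≢_) (u ∷ w ∷ cs) → All (z ≢_) (w ∷ cs) →
                     NonBacktracking (u ∷ w ∷ cs ++ y ∷ z ∷ [])
nonBacktracking-++ []       _                        (y≢u ∷ _) (z≢w ∷ _) =
  ≢-sym y≢u ∷ (≢-sym z≢w ∷ [-,-])
nonBacktracking-++ (c ∷ cs) ((_ ∷ u≢c ∷ _) ∷ distinct) (_ ∷ y∉) (_ ∷ z∉) =
  u≢c ∷ nonBacktracking-++ cs distinct y∉ z∉

data LastStep {A : Set} (R : A → A → Set) : List A → Set where
  [_] : ∀ {a b} → R a b → LastStep R (a ∷ b ∷ [])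
  _∷_ : ∀ a {as} → LastStep R as → LastStep R (a ∷ as)

lastStep-++ : ∀ {A : Set} {R : A → A → Set} ws {y z} → R y z → LastStep R (ws ++ y ∷ z ∷ [])
lastStep-++ []       r = [ r ]
lastStep-++ (w ∷ ws) r = w ∷ lastStep-++ ws r

Linked-extend : ∀ {A : Set} {R : A → A → Set} ws {y z} →
                Linked R (ws ++ y ∷ []) → R y z → Linked R (ws ++ y ∷ z ∷ [])
Linked-extend []           _           r = r ∷ [-]
Linked-extend (_ ∷ [])     (r′ ∷ [-])  r = r′ ∷ r ∷ [-]
Linked-extend (_ ∷ v ∷ ws) (r′ ∷ rs)   r = r′ ∷ Linked-extend (v ∷ ws) rs r

Linked-noReturn : ∀ {A : Set} {R : A → A → Set} → Transitive R → (∀ {a} → ¬ R a a) →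
                  ∀ {x} ws {vs} → ¬ Linked R (x ∷ ws ++ x ∷ vs)
Linked-noReturn R-trans R-irrefl ws chain with Linked⇒AllPairs R-trans chain
... | x-before ∷ _ = R-irrefl (All.head (++⁻ʳ ws x-before))

-- Trees given by a parent function

IsParent : {V : Set} → V → (V → V) → V → V → Set
IsParent root parent u w = w ≢ root × u ≡ parent w

record ParentFunction {V : Set} (E : V → V → Set) (root : V) : Set where
  field
    parent : V → V
    rank   : V → ℕ
    climbs : ∀ u → u ≢ root → E u (parent u) × rank (parent u) ℕ.< rank u
    edge   : ∀ {u w} → E u w → IsParent root parent u w ⊎ IsParent root parent w u

module ParentFunctionProperties {V : Set} {E : V → V → Set} {root : V}
                                (P : ParentFunction E root) where
  open ParentFunction P

  _⋖_ : V → V → Set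
  _⋖_ = IsParent root parent

  ⋖⇒rank< : ∀ {u w} → u ⋖ w → rank u ℕ.< rank w
  ⋖⇒rank< {w = w} (w≢root , refl) = proj₂ (climbs w w≢root)

  ⋖-unique : ∀ {u v w} → u ⋖ w → v ⋖ w → u ≡ v
  ⋖-unique (_ , refl) (_ , refl) = refl

  ascend : ∀ {a b} cs → NonBacktracking (a ∷ b ∷ cs) → Linked E (a ∷ b ∷ cs) →
           a ⋖ b → Linked _⋖_ (a ∷ b ∷ cs)
  ascend []       _          _               a⋖b = a⋖b ∷ [-]
  ascend (c ∷ cs) (a≢c ∷ nb) (_ ∷ es@(e ∷ _)) a⋖b with edge e
  ... | inj₁ b⋖c = a⋖b ∷ ascend cs nb es b⋖c
  ... | inj₂ c⋖b = ⊥-elim (a≢c (⋖-unique a⋖b c⋖b))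

  descend : ∀ {a b} cs → NonBacktracking (a ∷ b ∷ cs) → Linked E (a ∷ b ∷ cs) →
            LastStep (flip _⋖_) (a ∷ b ∷ cs) → Linked (flip _⋖_) (a ∷ b ∷ cs)
  descend []       _          _        [ b⋖a ]       = b⋖a ∷ [-]
  descend []       _          _        (_ ∷ (_ ∷ ()))
  descend (c ∷ cs) (a≢c ∷ nb) (e ∷ es) (_ ∷ last) with descend cs nb es last
  ... | rest@(c⋖b ∷ _) with edge e
  ...   | inj₁ a⋖b = ⊥-elim (a≢c (⋖-unique a⋖b c⋖b))
  ...   | inj₂ b⋖a = b⋖a ∷ rest

module _ (G : Graph) {root : Fin (n G)} (P : ParentFunction (Adj G) root) where
  open ParentFunction P
  open ParentFunctionProperties P

  walkToRoot : ∀ u → Walk G u root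
  walkToRoot u = go u (On.wellFounded rank <-wellFounded u)
    where
    go : ∀ u → Acc (ℕ._<_ on rank) u → Walk G u root
    go u (acc smaller) with u ≟ root
    ... | yes refl    = here
    ... | no  u≢root  with climbs u u≢root
    ...   | u~parent , parent<u = step u~parent (go (parent u) (smaller parent<u))

  -- Continuing once more around the cycle to v₁ gives a non-backtracking walk: if it
  -- starts upwards every step goes up, if it ends downwards every step goes down, and
  -- either way x would outrank itself.
  acyclic : Acyclic G
  acyclic (_ , []         , s≤s () , _)
  acyclic (_ , _ ∷ []     , s≤s (s≤s ()) , _)
  acyclic (x , v₁ ∷ v₂ ∷ vs , _ , x∉@(_ ∷ x≢v₂ ∷ _) ∷ v₁∉ ∷ distinct , closed) =
    firstStep (edge (Linked.head closed))
    where
    walk : Linked (Adj G) (x ∷ v₁ ∷ v₂ ∷ vs ++ x ∷ v₁ ∷ [])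
    walk = Linked-extend (x ∷ v₁ ∷ v₂ ∷ vs) closed (Linked.head closed)

    nonBacktracking : NonBacktracking (x ∷ v₁ ∷ v₂ ∷ vs ++ x ∷ v₁ ∷ [])
    nonBacktracking = x≢v₂ ∷ nonBacktracking-++ vs (v₁∉ ∷ distinct) x∉ v₁∉

    firstStep : x ⋖ v₁ ⊎ v₁ ⋖ x → ⊥
    firstStep (inj₁ x⋖v₁) = Linked-noReturn ℕP.<-trans (ℕP.<-irrefl refl) (v₁ ∷ v₂ ∷ vs)
      (Linked.map ⋖⇒rank< (ascend _ nonBacktracking walk x⋖v₁))
    firstStep (inj₂ v₁⋖x) = Linked-noReturn (flip ℕP.<-trans) (ℕP.<-irrefl refl) (v₁ ∷ v₂ ∷ vs)
      (Linked.map ⋖⇒rank< (descend _ nonBacktracking walk (lastStep-++ (x ∷ v₁ ∷ v₂ ∷ vs) v₁⋖x)))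

  parentFunction⇒isTree : IsTree G
  parentFunction⇒isTree = ℕP.≤-<-trans z≤n (toℕ<n root)
                        , (λ u v → walkToRoot u ++ʷ reverseʷ (walkToRoot v))
                        , acyclic

pullback : ∀ {A B : Set} {E : B → B → Set} {root : B} (to : A → B) (from : B → A) →
           (∀ b → to (from b) ≡ b) → (∀ a → from (to a) ≡ a) →
           ParentFunction E root → ParentFunction (E on to) (from root)
pullback {E = E} {root = root} to from to∘from from∘to P = record
  { parent = from ∘ parent ∘ to
  ; rank   = rank ∘ to
  ; climbs = climbs′
  ; edge   = Sum.map lift lift ∘ edge
  }
  where
  open ParentFunction P

  climbs′ : ∀ a → a ≢ from root →
            E (to a) (to (from (parent (to a)))) × rank (to (from (parent (to a)))) ℕ.< rank (to a)
  climbs′ a a≢root rewrite to∘from (parent (to a)) =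
    climbs (to a) (λ to-a≡root → a≢root (trans (≡.sym (from∘to a)) (cong from to-a≡root)))

  lift : ∀ {a a′} → IsParent root parent (to a) (to a′) → IsParent (from root) (from ∘ parent ∘ to) a a′
  lift {a} (to-a′≢root , to-a≡) =
    (λ a′≡root → to-a′≢root (trans (cong to a′≡root) (to∘from root))) ,
    trans (≡.sym (from∘to a)) (cong from to-a≡)

module ParentArrayTree {t} (p : Fin t → Fin (suc t)) (p≤ : ∀ i → toℕ (p i) ℕ.≤ toℕ i) where

  isParentᵇ : Fin (suc t) → Fin (suc t) → Bool
  isParentᵇ u zero    = false
  isParentᵇ u (suc i) = does (u ≟ p i)

  isParentᵇ-irrefl : ∀ u → isParentᵇ u u ≡ false
  isParentᵇ-irrefl zero    = refl
  isParentᵇ-irrefl (suc i) = dec-false (suc i ≟ p i)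
    (λ i+1≡p-i → ℕP.<-irrefl refl (subst (λ v → toℕ v ℕ.≤ toℕ i) (≡.sym i+1≡p-i) (p≤ i)))

  tree : Graph
  tree = record
    { n      = suc t
    ; adj    = λ u w → isParentᵇ u w ∨ isParentᵇ w u
    ; sym    = λ u w → ∨-comm (isParentᵇ u w) (isParentᵇ w u)
    ; irrefl = λ u → cong₂ _∨_ (isParentᵇ-irrefl u) (isParentᵇ-irrefl u)
    }

  parent : Fin (suc t) → Fin (suc t)
  parent zero    = zero
  parent (suc i) = p i

  isParentᵇ-sound : ∀ {u w} → isParentᵇ u w ≡ true → IsParent zero parent u w
  isParentᵇ-sound {u} {suc i} u≡p-i with u ≟ p i
  ... | yes u≡p-i = (λ ()) , u≡p-i
  isParentᵇ-sound {u} {suc i} () | no _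

  parentFunction : ParentFunction (Adj tree) zero
  parentFunction = record { parent = parent ; rank = toℕ ; climbs = climbs ; edge = edge }
    where
    climbs : ∀ u → u ≢ zero → Adj tree u (parent u) × toℕ (parent u) ℕ.< toℕ u
    climbs zero    0≢0 = ⊥-elim (0≢0 refl)
    climbs (suc i) _   = trans (cong (isParentᵇ (suc i) (p i) ∨_) (dec-true (p i ≟ p i) refl)) (∨-zeroʳ _)
                       , s≤s (p≤ i)

    edge : ∀ {u w} → Adj tree u w → IsParent zero parent u w ⊎ IsParent zero parent w u
    edge {u} {w} adjacent with isParentᵇ u w in u-parent
    ... | true  = inj₁ (isParentᵇ-sound u-parent)
    ... | false = inj₂ (isParentᵇ-sound adjacent)

module Path (t : ℕ) = ParentArrayTree {t} inject₁ (λ i → ℕP.≤-reflexive (toℕ-inject₁ i))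
module Star (t : ℕ) = ParentArrayTree {t} (λ _ → zero) (λ _ → z≤n)

IsSign : ℤ → Set
IsSign x = (x ≡ 1ℤ) ⊎ (x ≡ - 1ℤ)

sign≥-1 : ∀ {x} → IsSign x → -1ℤ ≤ x
sign≥-1 (inj₁ refl) = -≤+
sign≥-1 (inj₂ refl) = ℤP.≤-refl

sumOfThreeSigns-nonneg⇒positive : ∀ {a b c} → IsSign a → IsSign b → IsSign c →
                                  0ℤ ≤ a + (b + (c + 0ℤ)) → 1ℤ ≤ a + (b + (c + 0ℤ))
sumOfThreeSigns-nonneg⇒positive (inj₁ refl) (inj₁ refl) (inj₁ refl) _  = +≤+ (s≤s z≤n)
sumOfThreeSigns-nonneg⇒positive (inj₁ refl) (inj₁ refl) (inj₂ refl) _  = +≤+ (s≤s z≤n)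
sumOfThreeSigns-nonneg⇒positive (inj₁ refl) (inj₂ refl) (inj₁ refl) _  = +≤+ (s≤s z≤n)
sumOfThreeSigns-nonneg⇒positive (inj₂ refl) (inj₁ refl) (inj₁ refl) _  = +≤+ (s≤s z≤n)
sumOfThreeSigns-nonneg⇒positive (inj₁ refl) (inj₂ refl) (inj₂ refl) ()
sumOfThreeSigns-nonneg⇒positive (inj₂ refl) (inj₁ refl) (inj₂ refl) ()
sumOfThreeSigns-nonneg⇒positive (inj₂ refl) (inj₂ refl) (inj₁ refl) ()
sumOfThreeSigns-nonneg⇒positive (inj₂ refl) (inj₂ refl) (inj₂ refl) ()

0≤i+j⇒-i≤j : ∀ {i j} → 0ℤ ≤ i + j → - i ≤ j
0≤i+j⇒-i≤j {i} {j} 0≤i+j = begin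
  - i            ≡⟨ ℤP.+-identityʳ (- i) ⟨
  - i + 0ℤ       ≤⟨ ℤP.+-monoʳ-≤ (- i) 0≤i+j ⟩
  - i + (i + j)  ≡⟨ ℤP.+-assoc (- i) i j ⟨
  - i + i + j    ≡⟨ cong (λ x → x + j) (ℤP.+-inverseˡ i) ⟩
  0ℤ + j         ≡⟨ ℤP.+-identityˡ j ⟩
  j              ∎
  where open ℤP.≤-Reasoning

-- Hanging copies of a rooted tree from a new vertex

≟-comm : ∀ {k} (i j : Fin k) → does (i ≟ j) ≡ does (j ≟ i)
≟-comm i j with i ≟ j | j ≟ i
... | yes _   | yes _   = refl
... | no  _   | no  _   = refl
... | yes i≡j | no  j≢i = ⊥-elim (j≢i (≡.sym i≡j))
... | no  i≢j | yes j≡i = ⊥-elim (i≢j (≡.sym j≡i))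

module Hanging (L : Graph) (ρ : Fin (n L)) (m : ℕ) where

  data Vertex : Set where
    hub  : Vertex
    copy : Fin m → Fin (n L) → Vertex

  adjᵛ : Vertex → Vertex → Bool
  adjᵛ hub        hub        = false
  adjᵛ hub        (copy j s) = does (ρ ≟ s)
  adjᵛ (copy i r) hub        = does (ρ ≟ r)
  adjᵛ (copy i r) (copy j s) = does (i ≟ j) ∧ adj L r s

  adjᵛ-sym : ∀ d e → adjᵛ d e ≡ adjᵛ e d
  adjᵛ-sym hub        hub        = refl
  adjᵛ-sym hub        (copy j s) = refl
  adjᵛ-sym (copy i r) hub        = refl
  adjᵛ-sym (copy i r) (copy j s) = cong₂ _∧_ (≟-comm i j) (Graph.sym L r s)

  adjᵛ-irrefl : ∀ d → adjᵛ d d ≡ false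
  adjᵛ-irrefl hub                                      = refl
  adjᵛ-irrefl (copy i r) rewrite dec-true (i ≟ i) refl = Graph.irrefl L r

  decode : Fin (suc (m ℕ.* n L)) → Vertex
  decode zero    = hub
  decode (suc k) = uncurry copy (remQuot (n L) k)

  encode : Vertex → Fin (suc (m ℕ.* n L))
  encode hub        = zero
  encode (copy i r) = suc (combine i r)

  decode-encode : ∀ d → decode (encode d) ≡ d
  decode-encode hub        = refl
  decode-encode (copy i r) = cong (uncurry copy) (remQuot-combine i r)

  encode-decode : ∀ u → encode (decode u) ≡ u
  encode-decode zero    = refl
  encode-decode (suc k) = cong suc (combine-remQuot {m} (n L) k)

  hanging : Graph
  hanging = record
    { n      = suc (m ℕ.* n L)
    ; adj    = λ u w → adjᵛ (decode u) (decode w)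
    ; sym    = λ u w → adjᵛ-sym (decode u) (decode w)
    ; irrefl = adjᵛ-irrefl ∘ decode
    }

  module _ (P : ParentFunction (Adj L) ρ) where
    open ParentFunction P renaming (parent to parentᴸ; rank to rankᴸ; climbs to climbsᴸ; edge to edgeᴸ)

    Adjᵛ : Vertex → Vertex → Set
    Adjᵛ d e = adjᵛ d e ≡ true

    parentᵛ : Vertex → Vertex
    parentᵛ hub        = hub
    parentᵛ (copy i r) = if does (ρ ≟ r) then hub else copy i (parentᴸ r)

    rankᵛ : Vertex → ℕ
    rankᵛ hub        = 0
    rankᵛ (copy i r) = suc (rankᴸ r)

    climbsᵛ : ∀ d → d ≢ hub → Adjᵛ d (parentᵛ d) × rankᵛ (parentᵛ d) ℕ.< rankᵛ d
    climbsᵛ hub        hub≢hub = ⊥-elim (hub≢hub refl)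
    climbsᵛ (copy i r) _ with ρ ≟ r
    ... | yes ρ≡r = dec-true (ρ ≟ r) ρ≡r , s≤s z≤n
    ... | no ρ≢r rewrite dec-true (i ≟ i) refl =
      map₂ s≤s (climbsᴸ r (ρ≢r ∘ ≡.sym))

    hub⋖root : ∀ j s → Adjᵛ hub (copy j s) → IsParent hub parentᵛ hub (copy j s)
    hub⋖root j s _ with ρ ≟ s
    ... | yes _ = (λ ()) , refl
    hub⋖root j s () | no _

    within : ∀ i {r s} → IsParent ρ parentᴸ r s → IsParent hub parentᵛ (copy i r) (copy i s)
    within i {s = s} (s≢ρ , r≡) with ρ ≟ s
    ... | yes ρ≡s = ⊥-elim (s≢ρ (≡.sym ρ≡s))
    ... | no  _   = (λ ()) , cong (copy i) r≡

    edgeᵛ : ∀ {d e} → Adjᵛ d e → IsParent hub parentᵛ d e ⊎ IsParent hub parentᵛ e d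
    edgeᵛ {hub}      {hub}      ()
    edgeᵛ {hub}      {copy j s} a = inj₁ (hub⋖root j s a)
    edgeᵛ {copy i r} {hub}      a = inj₂ (hub⋖root i r a)
    edgeᵛ {copy i r} {copy j s} a with i ≟ j
    ... | yes refl = Sum.map (within i) (within i) (edgeᴸ a)
    edgeᵛ {copy i r} {copy j s} () | no _

    isTree : IsTree hanging
    isTree = parentFunction⇒isTree hanging (pullback decode encode decode-encode encode-decode
      (record { parent = parentᵛ ; rank = rankᵛ ; climbs = climbsᵛ ; edge = edgeᵛ }))

  sumFin-vertices : (F : Fin (suc (m ℕ.* n L)) → ℤ) →
                    sumFin F ≡ F (encode hub) + sumFin (λ i → sumFin (λ r → F (encode (copy i r))))
  sumFin-vertices F = cong (λ x → F zero + x) (sumFin-combine m (F ∘ suc))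

  closedNbhdSumᵛ : (Vertex → ℤ) → Vertex → ℤ
  closedNbhdSumᵛ ψ hub        = ψ hub + sumFin (λ i → ψ (copy i ρ))
  closedNbhdSumᵛ ψ (copy i r) = ψ (copy i r) + ((if does (ρ ≟ r) then ψ hub else 0ℤ)
                                              + sumFin (λ s → if adj L r s then ψ (copy i s) else 0ℤ))

  weightᵛ : (Vertex → ℤ) → ℤ
  weightᵛ ψ = ψ hub + sumFin (λ i → sumFin (λ r → ψ (copy i r)))

  closedNbhdSumᵛ-cong : ∀ {ψ χ} → (∀ d → ψ d ≡ χ d) → ∀ d → closedNbhdSumᵛ ψ d ≡ closedNbhdSumᵛ χ d
  closedNbhdSumᵛ-cong ψ≗χ hub        = cong₂ _+_ (ψ≗χ hub) (sumFin-cong (λ i → ψ≗χ (copy i ρ)))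
  closedNbhdSumᵛ-cong ψ≗χ (copy i r) = cong₂ _+_ (ψ≗χ (copy i r)) (cong₂ _+_
    (cong (λ x → if does (ρ ≟ r) then x else 0ℤ) (ψ≗χ hub))
    (sumFin-cong (λ s → cong (λ x → if adj L r s then x else 0ℤ) (ψ≗χ (copy i s)))))

  weightᵛ-cong : ∀ {ψ χ} → (∀ d → ψ d ≡ χ d) → weightᵛ ψ ≡ weightᵛ χ
  weightᵛ-cong ψ≗χ = cong₂ _+_ (ψ≗χ hub) (sumFin-cong (λ i → sumFin-cong (λ r → ψ≗χ (copy i r))))

  neighbourSum : ∀ (g : Fin (suc (m ℕ.* n L)) → ℤ) d →
    sumFin (λ w → if adjᵛ (decode (encode d)) (decode w) then g w else 0ℤ) ≡
    (if adjᵛ d hub then g (encode hub) else 0ℤ) +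
    sumFin (λ j → sumFin (λ s → if adjᵛ d (copy j s) then g (encode (copy j s)) else 0ℤ))
  neighbourSum g d rewrite decode-encode d =
    trans (sumFin-vertices (λ w → if adjᵛ d (decode w) then g w else 0ℤ))
          (cong (λ x → (if adjᵛ d hub then g (encode hub) else 0ℤ) + x)
                (sumFin-cong (λ j → sumFin-cong (λ s →
                  cong (λ e → if adjᵛ d e then g (encode (copy j s)) else 0ℤ) (decode-encode (copy j s))))))

  closedNbhdSum-encode : ∀ g d → closedNbhdSum hanging g (encode d) ≡ closedNbhdSumᵛ (g ∘ encode) d
  closedNbhdSum-encode g hub = cong (λ x → g zero + x) (begin
    sumFin (λ w → if adjᵛ hub (decode w) then g w else 0ℤ)
      ≡⟨ neighbourSum g hub ⟩
    0ℤ + sumFin (λ j → sumFin (λ s → if does (ρ ≟ s) then g (encode (copy j s)) else 0ℤ))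
      ≡⟨ ℤP.+-identityˡ _ ⟩
    sumFin (λ j → sumFin (λ s → if does (ρ ≟ s) then g (encode (copy j s)) else 0ℤ))
      ≡⟨ sumFin-cong (λ j → sumFin-indicator ρ (λ s → g (encode (copy j s)))) ⟩
    sumFin (λ j → g (encode (copy j ρ)))
      ∎)
    where open ≡.≡-Reasoning
  closedNbhdSum-encode g (copy i r) = cong (λ x → g (encode (copy i r)) + x) (begin
    sumFin (λ w → if adjᵛ (decode (encode (copy i r))) (decode w) then g w else 0ℤ)
      ≡⟨ neighbourSum g (copy i r) ⟩
    hubTerm + sumFin (λ j → sumFin (λ s → if does (i ≟ j) ∧ adj L r s then g (encode (copy j s)) else 0ℤ))
      ≡⟨ cong (λ x → hubTerm + x) (sumFin-cong (λ j → sumFin-∧ (does (i ≟ j)) (adj L r) _)) ⟩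
    hubTerm + sumFin (λ j → if does (i ≟ j) then legSum j else 0ℤ)
      ≡⟨ cong (λ x → hubTerm + x) (sumFin-indicator i legSum) ⟩
    hubTerm + legSum i
      ∎)
    where
    open ≡.≡-Reasoning
    hubTerm : ℤ
    hubTerm = if does (ρ ≟ r) then g (encode hub) else 0ℤ
    legSum : Fin m → ℤ
    legSum j = sumFin (λ s → if adj L r s then g (encode (copy j s)) else 0ℤ)

  IsNNSDFᵛ : (Vertex → ℤ) → Set
  IsNNSDFᵛ ψ = (∀ d → IsSign (ψ d)) × (∀ d → 0ℤ ≤ closedNbhdSumᵛ ψ d)

  restrict : ∀ {g} → IsNNSDF hanging g → IsNNSDFᵛ (g ∘ encode)
  restrict {g} (sign , nonneg) =
    sign ∘ encode , λ d → subst (0ℤ ≤_) (closedNbhdSum-encode g d) (nonneg (encode d))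

  extend : ∀ {ψ} → IsNNSDFᵛ ψ → IsNNSDF hanging (ψ ∘ decode)
  extend {ψ} (sign , nonneg) = sign ∘ decode , λ u →
    subst (λ v → 0ℤ ≤ closedNbhdSum hanging (ψ ∘ decode) v) (encode-decode u)
      (subst (0ℤ ≤_) (≡.sym (atEncoded (decode u))) (nonneg (decode u)))
    where
    atEncoded : ∀ d → closedNbhdSum hanging (ψ ∘ decode) (encode d) ≡ closedNbhdSumᵛ ψ d
    atEncoded d = trans (closedNbhdSum-encode (ψ ∘ decode) d)
                        (closedNbhdSumᵛ-cong (cong ψ ∘ decode-encode) d)

  nnSignedDomNumberIs : ∀ {k} → (Σ (Vertex → ℤ) λ ψ → IsNNSDFᵛ ψ × weightᵛ ψ ≡ k) →
                        (∀ ψ → IsNNSDFᵛ ψ → k ≤ weightᵛ ψ) → NNSignedDomNumberIs hanging k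
  nnSignedDomNumberIs {k} (ψ , nnsdf , weight≡k) minimal =
    (ψ ∘ decode , extend nnsdf ,
     trans (sumFin-vertices (ψ ∘ decode)) (trans (weightᵛ-cong (cong ψ ∘ decode-encode)) weight≡k)) ,
    λ g nnsdf-g → subst (k ≤_) (≡.sym (sumFin-vertices g)) (minimal (g ∘ encode) (restrict nnsdf-g))

nonnegativeValue : ∀ k → Σ Graph λ T → IsTree T × NNSignedDomNumberIs T (+ k)
nonnegativeValue k =
  hanging , isTree (Path.parentFunction 2) , nnSignedDomNumberIs (φ , (sign , nonneg) , weight≡) minimal
  where
  m : ℕ
  m = suc k
  open Hanging (Path.tree 2) 0F m

  φ : Vertex → ℤ
  φ hub         = -1ℤ
  φ (copy _ 2F) = -1ℤ
  φ (copy _ _)  = 1ℤ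

  sign : ∀ d → IsSign (φ d)
  sign hub         = inj₂ refl
  sign (copy _ 0F) = inj₁ refl
  sign (copy _ 1F) = inj₁ refl
  sign (copy _ 2F) = inj₂ refl

  nonneg : ∀ d → 0ℤ ≤ closedNbhdSumᵛ φ d
  nonneg hub         = subst (λ x → 0ℤ ≤ -1ℤ + x) (≡.sym (sumFin-one m)) (+≤+ z≤n)
  nonneg (copy _ 0F) = +≤+ z≤n
  nonneg (copy _ 1F) = +≤+ z≤n
  nonneg (copy _ 2F) = +≤+ z≤n

  weight≡ : weightᵛ φ ≡ + k
  weight≡ = cong (λ x → -1ℤ + x) (sumFin-one m)

  minimal : ∀ ψ → IsNNSDFᵛ ψ → + k ≤ weightᵛ ψ
  minimal ψ (sign , nonneg) = begin
    -1ℤ + + m                   ≡⟨ cong (λ x → -1ℤ + x) (sumFin-one m) ⟨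
    -1ℤ + sumFin {m} (λ _ → 1ℤ) ≤⟨ ℤP.+-mono-≤ (sign≥-1 (sign hub)) (sumFin-mono legWeight≥1) ⟩
    weightᵛ ψ                   ∎
    where
    open ℤP.≤-Reasoning
    middle : ∀ i → closedNbhdSumᵛ ψ (copy i 1F) ≡ sumFin (λ r → ψ (copy i r))
    middle i = rearrange (ψ (copy i 0F)) (ψ (copy i 1F)) (ψ (copy i 2F))
      where
      rearrange : ∀ a b c → b + (0ℤ + (a + (0ℤ + (c + 0ℤ)))) ≡ a + (b + (c + 0ℤ))
      rearrange = solve-∀
    legWeight≥1 : ∀ i → 1ℤ ≤ sumFin (λ r → ψ (copy i r))
    legWeight≥1 i = sumOfThreeSigns-nonneg⇒positive (sign _) (sign _) (sign _)
                      (subst (0ℤ ≤_) (middle i) (nonneg (copy i 1F)))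

negativeValue : ∀ k → Σ Graph λ T → IsTree T × NNSignedDomNumberIs T -[1+ k ]
negativeValue k =
  hanging , isTree (Star.parentFunction 2) , nnSignedDomNumberIs (φ , (sign , nonneg) , weight≡) minimal
  where
  m : ℕ
  m = suc (suc k)
  open Hanging (Star.tree 2) 0F m

  φ : Vertex → ℤ
  φ hub         = 1ℤ
  φ (copy _ 0F) = 1ℤ
  φ (copy _ _)  = -1ℤ

  sign : ∀ d → IsSign (φ d)
  sign hub         = inj₁ refl
  sign (copy _ 0F) = inj₁ refl
  sign (copy _ 1F) = inj₂ refl
  sign (copy _ 2F) = inj₂ refl

  nonneg : ∀ d → 0ℤ ≤ closedNbhdSumᵛ φ d
  nonneg hub         = subst (λ x → 0ℤ ≤ 1ℤ + x) (≡.sym (sumFin-one m)) (+≤+ z≤n)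
  nonneg (copy _ 0F) = +≤+ z≤n
  nonneg (copy _ 1F) = +≤+ z≤n
  nonneg (copy _ 2F) = +≤+ z≤n

  weight≡ : weightᵛ φ ≡ -[1+ k ]
  weight≡ = cong (λ x → 1ℤ + x) (sumFin-minusOne m)

  minimal : ∀ ψ → IsNNSDFᵛ ψ → -[1+ k ] ≤ weightᵛ ψ
  minimal ψ (sign , nonneg) = byHubSign (sign hub)
    where
    open ℤP.≤-Reasoning

    legWeight : Fin m → ℤ
    legWeight i = sumFin (λ r → ψ (copy i r))

    centre : ∀ i → closedNbhdSumᵛ ψ (copy i 0F) ≡ ψ hub + legWeight i
    centre i = rearrange (ψ hub) (ψ (copy i 0F)) (ψ (copy i 1F)) (ψ (copy i 2F))
      where
      rearrange : ∀ h a b c → a + (h + (0ℤ + (b + (c + 0ℤ)))) ≡ h + (a + (b + (c + 0ℤ)))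
      rearrange = solve-∀

    legWeight≥-hub : ∀ i → - ψ hub ≤ legWeight i
    legWeight≥-hub i = 0≤i+j⇒-i≤j (subst (0ℤ ≤_) (centre i) (nonneg (copy i 0F)))

    weight≥ : ∀ {h} → ψ hub ≡ h → h + sumFin {m} (λ _ → - h) ≤ weightᵛ ψ
    weight≥ refl = ℤP.+-monoʳ-≤ (ψ hub) (sumFin-mono legWeight≥-hub)

    byHubSign : IsSign (ψ hub) → -[1+ k ] ≤ weightᵛ ψ
    byHubSign (inj₁ hub≡1) = begin
      1ℤ + - + m                  ≡⟨ cong (λ x → 1ℤ + x) (sumFin-minusOne m) ⟨
      1ℤ + sumFin {m} (λ _ → -1ℤ) ≤⟨ weight≥ hub≡1 ⟩
      weightᵛ ψ                   ∎
    byHubSign (inj₂ hub≡-1) = begin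
      -[1+ k ]                    ≤⟨ -≤+ ⟩
      -1ℤ + + m                   ≡⟨ cong (λ x → -1ℤ + x) (sumFin-one m) ⟨
      -1ℤ + sumFin {m} (λ _ → 1ℤ) ≤⟨ weight≥ hub≡-1 ⟩
      weightᵛ ψ                   ∎

mainTheorem5 : (k : ℤ) → Σ Graph λ T → IsTree T × NNSignedDomNumberIs T k
mainTheorem5 (+ k)    = nonnegativeValue k
mainTheorem5 -[1+ k ] = negativeValue k
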